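{- Let $S$ be a finite, non-empty set of positive integers, let $\pi$ be a probability distribution on $S$, and for each $i\in S$ let $p_i\in[0,1]$. Let $f: S\to S\cup\{0\}$ be a random map whose values $f(i)$, $i\in S$, are chosen independently, where for each $i$, with probability $p_i$ the value $f(i)$ is drawn from $S$ according to $\pi$, and otherwise $f(i)=0$. Then the probability that $f$ has a cycle equals $\sum_{i\in S} p_i\,\pi(i)$. In particular, if $p_i=p$ for all $i\in S$, then the probability that $f$ has a cycle is $p$. Moreover, this probability equals the expected number of fixed points of $f$.
   Context: A cycle of a map $f: S\to S\cup\{0\}$ is a sequence $a_1,\dots,a_k$ ($k\ge 1$) of elements of $S$ such that $f(a_j)=a_{j+1}$ for $j=1,\dots,k-1$ and $f(a_k)=a_1$; fixed points count as cycles, and $0$ cannot lie on a cycle. A fixed point of $f$ is an $i\in S$ with $f(i)=i$. -}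

module Defs where

open import Level using (Level)
open import Algebra.Bundles using (CommutativeRing)
open import Data.Nat using (ℕ; zero; suc)
open import Data.Fin using (Fin; zero; suc; _≟_; inject₁; fromℕ)
open import Data.Maybe using (Maybe; just; nothing)
open import Data.List using (List; []; _∷_; map; concatMap; foldr)
open import Data.Product using (Σ; ∃; _×_)
open import Data.Vec.Functional using (Vector) renaming (_∷_ to _∷ᵥ_)
open import Relation.Binary.PropositionalEquality using (_≡_)
open import Data.Maybe.Properties using (≡-dec)
open import Relation.Nullary using (Dec; yes; no)

-- The finite set S is modelled as Fin n; the extra value 0 is `nothing`.
-- A map f : S → S ∪ {0}.
Map : ℕ → Set
Map n = Fin n → Maybe (Fin n)

IsCycle : ∀ {n} (f : Map n) (k : ℕ) (a : Fin (suc k) → Fin n) → Set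
IsCycle f k a =
  ((j : Fin k) → f (a (inject₁ j)) ≡ just (a (suc j))) ×
  (f (a (fromℕ k)) ≡ just (a zero))

HasCycle : ∀ {n} → Map n → Set
HasCycle {n} f = Σ ℕ λ k → Σ (Fin (suc k) → Fin n) λ a → IsCycle f k a

allFuns : ∀ {a} {A : Set a} (m : ℕ) → List A → List (Vector A m)
allFuns zero    xs = (λ ()) ∷ []
allFuns (suc m) xs = concatMap (λ x → map (λ g → x ∷ᵥ g) (allFuns m xs)) xs

allFinL : (n : ℕ) → List (Fin n)
allFinL zero    = []
allFinL (suc n) = zero ∷ map suc (allFinL n)

allMaps : (n : ℕ) → List (Map n)
allMaps n = allFuns n (nothing ∷ map just (allFinL n))

module _ {c ℓ : Level} (R : CommutativeRing c ℓ) where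
  open CommutativeRing R using (Carrier; _+_; _*_; _-_; 0#; 1#)

  sumL : ∀ {a} {A : Set a} → (A → Carrier) → List A → Carrier
  sumL g xs = foldr (λ x acc → g x + acc) 0# xs

  ∑ : ∀ {n} → (Fin n → Carrier) → Carrier
  ∑ {zero}  g = 0#
  ∑ {suc n} g = g zero + ∑ (λ i → g (suc i))

  ∏ : ∀ {n} → (Fin n → Carrier) → Carrier
  ∏ {zero}  g = 1#
  ∏ {suc n} g = g zero * ∏ (λ i → g (suc i))

  indicator : ∀ {p} {P : Set p} → Dec P → Carrier
  indicator (yes _) = 1#
  indicator (no _)  = 0#

  valueWeight : ∀ {n} (p π : Fin n → Carrier) → Fin n → Maybe (Fin n) → Carrier
  valueWeight p π i nothing  = 1# - p i
  valueWeight p π i (just j) = p i * π j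

  mapWeight : ∀ {n} (p π : Fin n → Carrier) → Map n → Carrier
  mapWeight p π f = ∏ (λ i → valueWeight p π i (f i))

  probCycle : ∀ {n} (p π : Fin n → Carrier) →
              ((f : Map n) → Dec (HasCycle f)) → Carrier
  probCycle {n} p π d = sumL (λ f → mapWeight p π f * indicator (d f)) (allMaps n)

  numFixed : ∀ {n} → Map n → Carrier
  numFixed f = ∑ (λ i → indicator (≡-dec _≟_ (f i) (just i)))

  expFixed : ∀ {n} (p π : Fin n → Carrier) → Carrier
  expFixed {n} p π = sumL (λ f → mapWeight p π f * numFixed f) (allMaps n)

module Submission where

-- Call a nonempty set of points that f maps into itself a trap. A map has a cycle iff it has a
-- trap, since an orbit inside a trap must revisit a point. Traps survive contraction: if f(0) ≠ 0,
-- delete the point 0 and redirect every arrow into 0 to f(0) (to the sink if f(0) is the sink);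
-- the contracted map has a trap iff f has one. The contracted values are again independent, with
-- f(i) = k with probability p_i (π_k + π_0 [f(0) = k]). Conditioning on f(0) and using induction
-- on |S|, with X = Σ_{i>0} p_i π_i and p_sink = 0,
--   P(cycle) = p_0 π_0 + Σ_{v ≠ 0} P(f(0) = v) (X + π_0 p_v) = p_0 π_0 + X (1 - p_0 π_0) + π_0 p_0 X
--            = p_0 π_0 + X.
-- Only P(f(i) = j) = p_i π_j and the total mass 1 of each f(i) enter, so the computation works
-- for weights in any commutative ring. The expected number of fixed points is Σ_i P(f(i) = i) by
-- linearity.

open import Defs
open import Level using (Level; _⊔_; 0ℓ) renaming (suc to lsuc)
open import Algebra.Bundles using (CommutativeRing)
open import Data.Nat as ℕ using (ℕ; zero; suc)
import Data.Nat.Properties as ℕₚ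
open import Data.Fin using (Fin; zero; suc; toℕ; inject₁; fromℕ; _≟_)
open import Data.Fin.Properties using (pigeonhole; toℕ-inject₁; toℕ-fromℕ)
open import Data.Product using (_×_; _,_; ∃; ∃-syntax; proj₁; proj₂)
open import Data.Sum using (_⊎_; inj₁; inj₂)
open import Data.Maybe as Maybe using (Maybe; just; nothing; maybe)
open import Data.Maybe.Properties using (≡-dec)
open import Data.List as List using (List; []; _∷_; _++_; concatMap)
open import Data.Vec.Functional using (Vector) renaming (_∷_ to _∷ᵥ_)
open import Function using (_∘_; _⇔_; mk⇔; Equivalence)
import Function.Properties.Equivalence as ⇔
open import Relation.Nullary using (¬_; Dec; yes; no; contradiction)
open import Relation.Nullary.Decidable using (map′)
open import Relation.Binary.PropositionalEquality as ≡ using (_≡_; _≗_; module ≡-Reasoning)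
import Algebra.Solver.Ring.NaturalCoefficients.Default as NaturalCoefficients

record Trap {n} (f : Map n) : Set₁ where
  constructor trap
  field
    Member : Fin n → Set
    root   : Fin n
    root∈  : Member root
    step   : ∀ {i} → Member i → ∃[ j ] f i ≡ just j × Member j

trap-resp-≗ : ∀ {n} {f g : Map n} → f ≗ g → Trap f → Trap g
trap-resp-≗ f≗g (trap M r r∈ st) =
  trap M r r∈ λ m → let j , fi≡j , j∈ = st m in j , ≡.trans (≡.sym (f≗g _)) fi≡j , j∈

trap-cong : ∀ {n} {f g : Map n} → f ≗ g → Trap f ⇔ Trap g
trap-cong f≗g = mk⇔ (trap-resp-≗ f≗g) (trap-resp-≗ (≡.sym ∘ f≗g))

no-trap-Fin0 : (f : Map 0) → ¬ Trap f
no-trap-Fin0 f (trap _ () _ _)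

fixedPoint⇒trap : ∀ {n} {f : Map n} {i} → f i ≡ just i → Trap f
fixedPoint⇒trap {i = i} fi≡i = trap (i ≡_) i ≡.refl λ { ≡.refl → i , fi≡i , ≡.refl }

fromℕ-or-inject₁ : ∀ {k} (t : Fin (suc k)) → t ≡ fromℕ k ⊎ ∃[ t′ ] t ≡ inject₁ t′
fromℕ-or-inject₁ {zero}  zero    = inj₁ ≡.refl
fromℕ-or-inject₁ {suc k} zero    = inj₂ (zero , ≡.refl)
fromℕ-or-inject₁ {suc k} (suc t) with fromℕ-or-inject₁ t
... | inj₁ t≡k         = inj₁ (≡.cong suc t≡k)
... | inj₂ (t′ , t≡t′) = inj₂ (suc t′ , ≡.cong suc t≡t′)

cycle⇒trap : ∀ {n} {f : Map n} → HasCycle f → Trap f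
cycle⇒trap {n} {f} (k , a , steps , closing) = trap OnCycle (a zero) (zero , ≡.refl) next
  where
  OnCycle : Fin n → Set
  OnCycle i = ∃[ t ] a t ≡ i
  next : ∀ {i} → OnCycle i → ∃[ j ] f i ≡ just j × OnCycle j
  next (t , ≡.refl) with fromℕ-or-inject₁ t
  ... | inj₁ ≡.refl        = a zero , closing , zero , ≡.refl
  ... | inj₂ (t′ , ≡.refl) = a (suc t′) , steps t′ , suc t′ , ≡.refl

orbit⇒cycle : ∀ {n} {f : Map n} (x : ℕ → Fin n) → (∀ m → f (x m) ≡ just (x (suc m))) → HasCycle f
orbit⇒cycle {n} {f} x x-step with pigeonhole (ℕₚ.n<1+n n) (x ∘ toℕ)
... | u , v , u<v , xu≡xv with ℕₚ.m≤n⇒∃[o]m+o≡n u<v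
...   | k , 1+u+k≡v = k , (λ t → x (U ℕ.+ toℕ t)) , steps , closing
  where
  open ≡-Reasoning
  U = toℕ u
  steps : ∀ t → f (x (U ℕ.+ toℕ (inject₁ t))) ≡ just (x (U ℕ.+ toℕ (suc t)))
  steps t = begin
    f (x (U ℕ.+ toℕ (inject₁ t))) ≡⟨ ≡.cong (λ m → f (x (U ℕ.+ m))) (toℕ-inject₁ t) ⟩
    f (x (U ℕ.+ toℕ t))           ≡⟨ x-step (U ℕ.+ toℕ t) ⟩
    just (x (suc (U ℕ.+ toℕ t)))  ≡⟨ ≡.cong (just ∘ x) (ℕₚ.+-suc U (toℕ t)) ⟨
    just (x (U ℕ.+ suc (toℕ t)))  ∎
  closing : f (x (U ℕ.+ toℕ (fromℕ k))) ≡ just (x (U ℕ.+ 0))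
  closing = begin
    f (x (U ℕ.+ toℕ (fromℕ k))) ≡⟨ ≡.cong (λ m → f (x (U ℕ.+ m))) (toℕ-fromℕ k) ⟩
    f (x (U ℕ.+ k))             ≡⟨ x-step (U ℕ.+ k) ⟩
    just (x (suc (U ℕ.+ k)))    ≡⟨ ≡.cong (just ∘ x) 1+u+k≡v ⟩
    just (x (toℕ v))            ≡⟨ ≡.cong just xu≡xv ⟨
    just (x U)                  ≡⟨ ≡.cong (just ∘ x) (ℕₚ.+-identityʳ U) ⟨
    just (x (U ℕ.+ 0))          ∎

trap⇒cycle : ∀ {n} {f : Map n} → Trap f → HasCycle f
trap⇒cycle {f = f} (trap M r r∈ st) =
  orbit⇒cycle {f = f} (proj₁ ∘ orbit) (λ m → proj₁ (proj₂ (st (proj₂ (orbit m)))))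
  where
  orbit : ℕ → ∃ M
  orbit zero    = r , r∈
  orbit (suc m) = let j , _ , j∈ = st (proj₂ (orbit m)) in j , j∈

cycle⇔trap : ∀ {n} {f : Map n} → HasCycle f ⇔ Trap f
cycle⇔trap = mk⇔ cycle⇒trap trap⇒cycle

shift : ∀ {n} → Maybe (Fin n) → Maybe (Fin (suc n))
shift = Maybe.map suc

-- redirect (f 0) (f (suc i)) is the value at i of the map contracted along f 0.
redirect : ∀ {n} → Maybe (Fin n) → Maybe (Fin (suc n)) → Maybe (Fin n)
redirect t nothing        = nothing
redirect t (just zero)    = t
redirect t (just (suc k)) = just k

redirect-shift : ∀ {n} (t u : Maybe (Fin n)) → redirect t (shift u) ≡ u
redirect-shift t nothing  = ≡.refl
redirect-shift t (just k) = ≡.refl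

shift≡just : ∀ {n} (t : Maybe (Fin n)) {j} → shift t ≡ just j → ∃[ k ] t ≡ just k × j ≡ suc k
shift≡just (just k) ≡.refl = k , ≡.refl , ≡.refl

redirect≡just : ∀ {n} (t : Maybe (Fin n)) (v : Maybe (Fin (suc n))) {j} → redirect t v ≡ just j →
                v ≡ just zero × t ≡ just j ⊎ v ≡ just (suc j)
redirect≡just t (just zero)    t≡j    = inj₁ (≡.refl , t≡j)
redirect≡just t (just (suc k)) ≡.refl = inj₂ ≡.refl

trap-contract : ∀ {n} (t : Maybe (Fin n)) (g : Vector (Maybe (Fin (suc n))) n) →
                Trap (shift t ∷ᵥ g) ⇔ Trap (redirect t ∘ g)
trap-contract {n} t g = mk⇔ to from
  where
  to : Trap (shift t ∷ᵥ g) → Trap (redirect t ∘ g)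
  to (trap M r r∈ st) = trap (M ∘ suc) (proj₁ (root′ r r∈)) (proj₂ (root′ r r∈)) step′
    where
    fromZero : M zero → ∃[ k ] t ≡ just k × M (suc k)
    fromZero m with st m
    ... | j , e , mj = let k , t≡k , j≡k = shift≡just t e in k , t≡k , ≡.subst M j≡k mj
    root′ : ∀ i → M i → ∃[ k ] M (suc k)
    root′ zero    m = let k , _ , mk = fromZero m in k , mk
    root′ (suc i) m = i , m
    step′ : ∀ {i} → M (suc i) → ∃[ j ] redirect t (g i) ≡ just j × M (suc j)
    step′ m with st m
    ... | zero  , gi≡0 , m₀ =
      let k , t≡k , mk = fromZero m₀ in k , ≡.trans (≡.cong (redirect t) gi≡0) t≡k , mk
    ... | suc j , gi≡j , mj = j , ≡.cong (redirect t) gi≡j , mj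
  from : Trap (redirect t ∘ g) → Trap (shift t ∷ᵥ g)
  from (trap M r r∈ st) = trap M⁺ (suc r) r∈ (λ {i} → step⁺ {i})
    where
    M⁺ : Fin (suc n) → Set
    M⁺ = (∃[ k ] t ≡ just k × M k) ∷ᵥ M
    step⁺ : ∀ {i} → M⁺ i → ∃[ j ] (shift t ∷ᵥ g) i ≡ just j × M⁺ j
    step⁺ {zero}  (k , t≡k , mk) = suc k , ≡.cong shift t≡k , mk
    step⁺ {suc i} m with st m
    ... | j , e , mj with redirect≡just t (g i) e
    ...   | inj₁ (gi≡0 , t≡j) = zero , gi≡0 , j , t≡j , mj
    ...   | inj₂ gi≡j         = suc j , gi≡j , mj

trap-shift : ∀ {n} (t : Maybe (Fin n)) (f : Map n) → Trap (shift t ∷ᵥ shift ∘ f) ⇔ Trap f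
trap-shift t f = ⇔.trans (trap-contract t (shift ∘ f)) (trap-cong (redirect-shift t ∘ f))

values : (n : ℕ) → List (Maybe (Fin n))
values n = nothing ∷ List.map just (allFinL n)

module Probability {c ℓ : Level} (R : CommutativeRing c ℓ) where
  open CommutativeRing R hiding (zero)
  open import Algebra.Properties.Semiring.Sum semiring
    using (sum; sum-cong-≋; sum-cong-≗; ∑-distrib-+; *-distribˡ-sum; sum-replicate-zero)
  open import Algebra.Properties.CommutativeSemigroup +-commutativeSemigroup
    using (interchange; x∙yz≈y∙xz)
  open import Algebra.Properties.Group +-group using (//-rightDividesˡ)
  open import Relation.Binary.Reasoning.Setoid setoid
  open NaturalCoefficients commutativeSemiring using (solve; _:=_; _:+_; _:*_; con)

  ∑≡sum : ∀ {n} (g : Fin n → Carrier) → ∑ R g ≡ sum g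
  ∑≡sum {zero}  g = ≡.refl
  ∑≡sum {suc n} g = ≡.cong (g zero +_) (∑≡sum (g ∘ suc))

  private variable
    a b : Level
    A : Set a
    B : Set b

  sumL-cong : {g h : A → Carrier} (xs : List A) → (∀ x → g x ≈ h x) → sumL R g xs ≈ sumL R h xs
  sumL-cong []       g≈h = refl
  sumL-cong (x ∷ xs) g≈h = +-cong (g≈h x) (sumL-cong xs g≈h)

  sumL-++ : (g : A → Carrier) (xs ys : List A) → sumL R g (xs ++ ys) ≈ sumL R g xs + sumL R g ys
  sumL-++ g []       ys = sym (+-identityˡ _)
  sumL-++ g (x ∷ xs) ys = trans (+-congˡ (sumL-++ g xs ys)) (sym (+-assoc _ _ _))

  *-distribˡ-sumL : (k : Carrier) (g : A → Carrier) (xs : List A) →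
                    k * sumL R g xs ≈ sumL R (λ x → k * g x) xs
  *-distribˡ-sumL k g []       = zeroʳ k
  *-distribˡ-sumL k g (x ∷ xs) = trans (distribˡ k _ _) (+-congˡ (*-distribˡ-sumL k g xs))

  sumL-distrib-+ : (g h : A → Carrier) (xs : List A) →
                   sumL R (λ x → g x + h x) xs ≈ sumL R g xs + sumL R h xs
  sumL-distrib-+ g h []       = sym (+-identityʳ 0#)
  sumL-distrib-+ g h (x ∷ xs) = trans (+-congˡ (sumL-distrib-+ g h xs)) (interchange _ _ _ _)

  sumL-map : (g : B → Carrier) (h : A → B) (xs : List A) → sumL R g (List.map h xs) ≡ sumL R (g ∘ h) xs
  sumL-map g h []       = ≡.refl
  sumL-map g h (x ∷ xs) = ≡.cong (g (h x) +_) (sumL-map g h xs)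

  sumL-concatMap : (g : B → Carrier) (F : A → List B) (xs : List A) →
                   sumL R g (concatMap F xs) ≈ sumL R (sumL R g ∘ F) xs
  sumL-concatMap g F []       = refl
  sumL-concatMap g F (x ∷ xs) =
    trans (sumL-++ g (F x) (concatMap F xs)) (+-congˡ (sumL-concatMap g F xs))

  sumL-allFinL : ∀ {n} (g : Fin n → Carrier) → sumL R g (allFinL n) ≡ sum g
  sumL-allFinL {zero}  g = ≡.refl
  sumL-allFinL {suc n} g =
    ≡.cong (g zero +_) (≡.trans (sumL-map g suc (allFinL n)) (sumL-allFinL (g ∘ suc)))

  data IsIndicator {q} (P : Set q) (x : Carrier) : Set (q ⊔ ℓ) where
    holds : P → x ≈ 1# → IsIndicator P x
    fails : ¬ P → x ≈ 0# → IsIndicator P x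

  module _ {p q} {P : Set p} {Q : Set q} where

    isIndicator-⇔ : ∀ {x} → P ⇔ Q → IsIndicator P x → IsIndicator Q x
    isIndicator-⇔ P⇔Q (holds p x≈1)  = holds (Equivalence.to P⇔Q p) x≈1
    isIndicator-⇔ P⇔Q (fails ¬p x≈0) = fails (¬p ∘ Equivalence.from P⇔Q) x≈0

    isIndicator-unique : ∀ {x y} → P ⇔ Q → IsIndicator P x → IsIndicator Q y → x ≈ y
    isIndicator-unique P⇔Q (holds _ x≈1) (holds _ y≈1) = trans x≈1 (sym y≈1)
    isIndicator-unique P⇔Q (fails _ x≈0) (fails _ y≈0) = trans x≈0 (sym y≈0)
    isIndicator-unique P⇔Q (holds p _)   (fails ¬q _)  = contradiction (Equivalence.to P⇔Q p) ¬q
    isIndicator-unique P⇔Q (fails ¬p _)  (holds q _)   = contradiction (Equivalence.from P⇔Q q) ¬p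

  isIndicator-holds : ∀ {q} {P : Set q} {x} → IsIndicator P x → P → x ≈ 1#
  isIndicator-holds (holds _ x≈1) _ = x≈1
  isIndicator-holds (fails ¬p _)  p = contradiction p ¬p

  isIndicator-fails : ∀ {q} {P : Set q} {x} → IsIndicator P x → ¬ P → x ≈ 0#
  isIndicator-fails (holds p _)   ¬p = contradiction p ¬p
  isIndicator-fails (fails _ x≈0) _  = x≈0

  indicator-isIndicator : ∀ {q} {P : Set q} (P? : Dec P) → IsIndicator P (indicator R P?)
  indicator-isIndicator (yes p) = holds p refl
  indicator-isIndicator (no ¬p) = fails ¬p refl

  indicator-map′ : ∀ {p q} {P : Set p} {Q : Set q} {to : P → Q} {from : Q → P} (P? : Dec P) →
                   indicator R (map′ to from P?) ≡ indicator R P?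
  indicator-map′ (yes _) = ≡.refl
  indicator-map′ (no _)  = ≡.refl

  δ : ∀ {n} → Maybe (Fin n) → Maybe (Fin n) → Carrier
  δ u t = indicator R (≡-dec _≟_ u t)

  *0+ : ∀ x y → x * 0# + y ≈ y
  *0+ x y = trans (+-congʳ (zeroʳ x)) (+-identityˡ y)

  sum-*0 : ∀ {n} (h : Fin n → Carrier) → sum (λ k → h k * 0#) ≈ 0#
  sum-*0 {n} h = trans (sum-cong-≋ (λ k → zeroʳ (h k))) (sum-replicate-zero n)

  sum-δ : ∀ {n} (h : Fin n → Carrier) (j : Fin n) → sum (λ k → h k * indicator R (k ≟ j)) ≈ h j
  sum-δ h zero    = trans (+-cong (*-identityʳ _) (sum-*0 (h ∘ suc))) (+-identityʳ _)
  sum-δ h (suc j) = begin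
    h zero * 0# + sum (λ k → h (suc k) * indicator R (suc k ≟ suc j)) ≈⟨ *0+ _ _ ⟩
    sum (λ k → h (suc k) * indicator R (suc k ≟ suc j))
      ≡⟨ sum-cong-≗ (λ k → ≡.cong (h (suc k) *_) (indicator-map′ (k ≟ j))) ⟩
    sum (λ k → h (suc k) * indicator R (k ≟ j))                       ≈⟨ sum-δ (h ∘ suc) j ⟩
    h (suc j)                                                         ∎

  -- Opaque, so that h can be inferred from sumMaybe h; sumMaybe-unfold states the definition.
  opaque
    sumMaybe : ∀ {n} → (Maybe (Fin n) → Carrier) → Carrier
    sumMaybe h = h nothing + sum (h ∘ just)

    sumMaybe-unfold : ∀ {n} (h : Maybe (Fin n) → Carrier) → sumMaybe h ≡ h nothing + sum (h ∘ just)
    sumMaybe-unfold h = ≡.refl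

    sumL-values : ∀ {n} (h : Maybe (Fin n) → Carrier) → sumL R h (values n) ≡ sumMaybe h
    sumL-values {n} h =
      ≡.cong (h nothing +_) (≡.trans (sumL-map h just (allFinL n)) (sumL-allFinL (h ∘ just)))

    sumMaybe-cong : ∀ {n} {g h : Maybe (Fin n) → Carrier} → (∀ u → g u ≈ h u) →
                    sumMaybe g ≈ sumMaybe h
    sumMaybe-cong g≈h = +-cong (g≈h nothing) (sum-cong-≋ (g≈h ∘ just))

    sumMaybe-distrib-+ : ∀ {n} (g h : Maybe (Fin n) → Carrier) →
                         sumMaybe (λ u → g u + h u) ≈ sumMaybe g + sumMaybe h
    sumMaybe-distrib-+ g h = trans (+-congˡ (∑-distrib-+ (g ∘ just) (h ∘ just))) (interchange _ _ _ _)

    *-distribˡ-sumMaybe : ∀ {n} (k : Carrier) (h : Maybe (Fin n) → Carrier) →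
                          k * sumMaybe h ≈ sumMaybe (λ u → k * h u)
    *-distribˡ-sumMaybe k h = trans (distribˡ k _ _) (+-congˡ (*-distribˡ-sum k (h ∘ just)))

    sumMaybe-shift : ∀ {n} (h : Maybe (Fin (suc n)) → Carrier) →
                     sumMaybe h ≈ h (just zero) + sumMaybe (h ∘ shift)
    sumMaybe-shift h = x∙yz≈y∙xz _ _ _

    sumMaybe-δ : ∀ {n} (h : Maybe (Fin n) → Carrier) (t : Maybe (Fin n)) →
                 sumMaybe (λ u → h u * δ u t) ≈ h t
    sumMaybe-δ h nothing  = trans (+-cong (*-identityʳ _) (sum-*0 (h ∘ just))) (+-identityʳ _)
    sumMaybe-δ h (just j) = begin
      h nothing * 0# + sum (λ k → h (just k) * δ (just k) (just j)) ≈⟨ *0+ _ _ ⟩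
      sum (λ k → h (just k) * δ (just k) (just j))
        ≡⟨ sum-cong-≗ (λ k → ≡.cong (h (just k) *_) (indicator-map′ (k ≟ j))) ⟩
      sum (λ k → h (just k) * indicator R (k ≟ j))                  ≈⟨ sum-δ (h ∘ just) j ⟩
      h (just j)                                                    ∎

  sum-δ-just : ∀ {n} (g : Fin n → Carrier) (t : Maybe (Fin n)) →
               sum (λ k → g k * δ (just k) t) ≈ maybe g 0# t
  sum-δ-just g t = begin
    sum (λ k → g k * δ (just k) t)                    ≈⟨ +-identityˡ _ ⟨
    0# + sum (λ k → g k * δ (just k) t)               ≈⟨ +-congʳ (zeroˡ _) ⟨
    0# * δ nothing t + sum (λ k → g k * δ (just k) t) ≡⟨ sumMaybe-unfold (λ u → maybe g 0# u * δ u t) ⟨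
    sumMaybe (λ u → maybe g 0# u * δ u t)             ≈⟨ sumMaybe-δ (maybe g 0#) t ⟩
    maybe g 0# t                                      ∎

  𝔼 : ∀ {v} {V : Set v} {M} → (Fin M → V → Carrier) → List V → (Vector V M → Carrier) → Carrier
  𝔼 {M = M} w xs G = sumL R (λ g → ∏ R (λ i → w i (g i)) * G g) (allFuns M xs)

  module _ {v} {V : Set v} (xs : List V) where

    𝔼-cong : ∀ {M} (w : Fin M → V → Carrier) {G G′ : Vector V M → Carrier} →
             (∀ g → G g ≈ G′ g) → 𝔼 w xs G ≈ 𝔼 w xs G′
    𝔼-cong {M} w G≈G′ = sumL-cong (allFuns M xs) (λ g → *-congˡ (G≈G′ g))

    𝔼-suc : ∀ {M} (w : Fin (suc M) → V → Carrier) (G : Vector V (suc M) → Carrier) →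
            𝔼 w xs G ≈ sumL R (λ x → w zero x * 𝔼 (w ∘ suc) xs (λ g → G (x ∷ᵥ g))) xs
    𝔼-suc {M} w G = begin
      𝔼 w xs G
        ≈⟨ sumL-concatMap _ (λ x → List.map (x ∷ᵥ_) (allFuns M xs)) xs ⟩
      sumL R (λ x → sumL R (λ f → W f * G f) (List.map (x ∷ᵥ_) (allFuns M xs))) xs
        ≈⟨ sumL-cong xs (λ x → reflexive (sumL-map _ (x ∷ᵥ_) (allFuns M xs))) ⟩
      sumL R (λ x → sumL R (λ g → (w zero x * W₊ g) * G (x ∷ᵥ g)) (allFuns M xs)) xs
        ≈⟨ sumL-cong xs (λ x → trans (sumL-cong (allFuns M xs) (λ g → *-assoc _ _ _))
                                     (sym (*-distribˡ-sumL (w zero x) _ (allFuns M xs)))) ⟩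
      sumL R (λ x → w zero x * 𝔼 (w ∘ suc) xs (λ g → G (x ∷ᵥ g))) xs ∎
      where
      W : Vector V (suc M) → Carrier
      W f = ∏ R (λ i → w i (f i))
      W₊ : Vector V M → Carrier
      W₊ g = ∏ R (λ i → w (suc i) (g i))

    𝔼-distrib-+ : ∀ {M} (w : Fin M → V → Carrier) (G G′ : Vector V M → Carrier) →
                  𝔼 w xs (λ g → G g + G′ g) ≈ 𝔼 w xs G + 𝔼 w xs G′
    𝔼-distrib-+ {M} w G G′ =
      trans (sumL-cong (allFuns M xs) (λ g → distribˡ _ _ _)) (sumL-distrib-+ _ _ (allFuns M xs))

    sumL-*ʳ-normalised : (w : V → Carrier) → sumL R w xs ≈ 1# → (k : Carrier) →
                         sumL R (λ x → w x * k) xs ≈ k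
    sumL-*ʳ-normalised w w≈1 k = begin
      sumL R (λ x → w x * k) xs ≈⟨ sumL-cong xs (λ x → *-comm _ _) ⟩
      sumL R (λ x → k * w x) xs ≈⟨ *-distribˡ-sumL k w xs ⟨
      k * sumL R w xs           ≈⟨ *-congˡ w≈1 ⟩
      k * 1#                    ≈⟨ *-identityʳ k ⟩
      k                         ∎

    𝔼-const : ∀ {M} (w : Fin M → V → Carrier) → (∀ i → sumL R (w i) xs ≈ 1#) → (k : Carrier) →
              𝔼 w xs (λ _ → k) ≈ k
    𝔼-const {zero}  w _   k = trans (+-identityʳ _) (*-identityˡ k)
    𝔼-const {suc M} w w≈1 k = begin
      𝔼 w xs (λ _ → k)                                      ≈⟨ 𝔼-suc w _ ⟩
      sumL R (λ x → w zero x * 𝔼 (w ∘ suc) xs (λ _ → k)) xs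
        ≈⟨ sumL-cong xs (λ x → *-congˡ (𝔼-const (w ∘ suc) (w≈1 ∘ suc) k)) ⟩
      sumL R (λ x → w zero x * k) xs                        ≈⟨ sumL-*ʳ-normalised (w zero) (w≈1 zero) k ⟩
      k                                                     ∎

    𝔼-sum : ∀ {M} (w : Fin M → V → Carrier) → (∀ i → sumL R (w i) xs ≈ 1#) →
            (h : Fin M → V → Carrier) →
            𝔼 w xs (λ g → sum (λ i → h i (g i))) ≈ sum (λ i → sumL R (λ x → w i x * h i x) xs)
    𝔼-sum {zero}  w _   h = trans (+-identityʳ _) (zeroʳ 1#)
    𝔼-sum {suc M} w w≈1 h = begin
      𝔼 w xs (λ g → sum (λ i → h i (g i)))
        ≈⟨ 𝔼-suc w _ ⟩
      sumL R (λ x → w zero x * 𝔼 (w ∘ suc) xs (λ g → h zero x + sum (λ i → h (suc i) (g i)))) xs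
        ≈⟨ sumL-cong xs (λ x → *-congˡ (inner x)) ⟩
      sumL R (λ x → w zero x * (h zero x + E₊)) xs
        ≈⟨ trans (sumL-cong xs (λ x → distribˡ _ _ _)) (sumL-distrib-+ _ _ xs) ⟩
      sumL R (λ x → w zero x * h zero x) xs + sumL R (λ x → w zero x * E₊) xs
        ≈⟨ +-congˡ (sumL-*ʳ-normalised (w zero) (w≈1 zero) E₊) ⟩
      sumL R (λ x → w zero x * h zero x) xs + E₊ ∎
      where
      E₊ : Carrier
      E₊ = sum (λ i → sumL R (λ x → w (suc i) x * h (suc i) x) xs)
      inner : ∀ x → 𝔼 (w ∘ suc) xs (λ g → h zero x + sum (λ i → h (suc i) (g i))) ≈ h zero x + E₊
      inner x = trans (𝔼-distrib-+ (w ∘ suc) _ _)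
                      (+-cong (𝔼-const (w ∘ suc) (w≈1 ∘ suc) (h zero x))
                              (𝔼-sum (w ∘ suc) (w≈1 ∘ suc) (h ∘ suc)))

  𝔼-pushforward : ∀ {v v′} {V : Set v} {V′ : Set v′} {M} (xs : List V) (ys : List V′) (φ : V → V′)
                  (w : Fin M → V → Carrier) (w′ : Fin M → V′ → Carrier) →
                  (∀ i (K : V′ → Carrier) →
                     sumL R (λ x → w i x * K (φ x)) xs ≈ sumL R (λ y → w′ i y * K y) ys) →
                  (H : Vector V′ M → Carrier) → (∀ g g′ → (∀ i → g i ≡ g′ i) → H g ≈ H g′) →
                  𝔼 w xs (H ∘ (φ ∘_)) ≈ 𝔼 w′ ys H
  𝔼-pushforward {M = zero} xs ys φ w w′ φ-law H H-resp = +-congʳ (*-congˡ (H-resp _ _ λ ()))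
  𝔼-pushforward {V′ = V′} {M = suc M} xs ys φ w w′ φ-law H H-resp = begin
    𝔼 w xs (H ∘ (φ ∘_))
      ≈⟨ 𝔼-suc xs w _ ⟩
    sumL R (λ x → w zero x * 𝔼 (w ∘ suc) xs (λ g → H (φ ∘ (x ∷ᵥ g)))) xs
      ≈⟨ sumL-cong xs (λ x → *-congˡ (trans (𝔼-cong xs (w ∘ suc) (λ g → H-resp _ _ (φ-∷ x g)))
                                            (pushed x))) ⟩
    sumL R (λ x → w zero x * K (φ x)) xs
      ≈⟨ φ-law zero K ⟩
    sumL R (λ y → w′ zero y * K y) ys
      ≈⟨ 𝔼-suc ys w′ H ⟨
    𝔼 w′ ys H ∎
    where
    K : V′ → Carrier
    K y = 𝔼 (w′ ∘ suc) ys (λ g′ → H (y ∷ᵥ g′))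
    φ-∷ : ∀ x g i → φ ((x ∷ᵥ g) i) ≡ (φ x ∷ᵥ φ ∘ g) i
    φ-∷ x g zero    = ≡.refl
    φ-∷ x g (suc i) = ≡.refl
    pushed : ∀ x → 𝔼 (w ∘ suc) xs (λ g → H (φ x ∷ᵥ φ ∘ g)) ≈ K (φ x)
    pushed x = 𝔼-pushforward xs ys φ (w ∘ suc) (w′ ∘ suc) (φ-law ∘ suc) (λ g′ → H (φ x ∷ᵥ g′))
                 (λ g g′ g≗g′ → H-resp _ _ λ { zero → ≡.refl ; (suc i) → g≗g′ i })

  -- The law of f(i) is w i. Only the total mass is prescribed at the sink, which makes the class
  -- closed under contraction.
  record IsValueLaw {n} (p π : Fin n → Carrier) (w : Fin n → Maybe (Fin n) → Carrier) :
                    Set (c ⊔ ℓ) where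
    field
      atPoint : ∀ i j → w i (just j) ≈ p i * π j
      total   : ∀ i → sumMaybe (w i) ≈ 1#

    total-values : ∀ i → sumL R (w i) (values n) ≈ 1#
    total-values i = trans (reflexive (sumL-values (w i))) (total i)

  -- The law of redirect t (f (suc i)) when f (suc i) has law w (suc i).
  contractedLaw : ∀ {n} → Maybe (Fin n) → (Fin (suc n) → Maybe (Fin (suc n)) → Carrier) →
                  Fin n → Maybe (Fin n) → Carrier
  contractedLaw t w i u = w (suc i) (shift u) + w (suc i) (just zero) * δ u t

  contractedDist : ∀ {n} → Maybe (Fin n) → (Fin (suc n) → Carrier) → Fin n → Carrier
  contractedDist t π k = π (suc k) + π zero * δ (just k) t

  sumMaybe-redirect : ∀ {n} (t : Maybe (Fin n)) (w : Maybe (Fin (suc n)) → Carrier)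
                      (K : Maybe (Fin n) → Carrier) →
                      sumMaybe (λ v → w v * K (redirect t v)) ≈
                      sumMaybe (λ u → (w (shift u) + w (just zero) * δ u t) * K u)
  sumMaybe-redirect t w K = begin
    sumMaybe (λ v → w v * K (redirect t v))
      ≈⟨ sumMaybe-shift _ ⟩
    w (just zero) * K t + sumMaybe (λ u → w (shift u) * K (redirect t (shift u)))
      ≈⟨ +-cong (*-congˡ (sym (sumMaybe-δ K t)))
                (sumMaybe-cong (λ u → *-congˡ (reflexive (≡.cong K (redirect-shift t u))))) ⟩
    w (just zero) * sumMaybe (λ u → K u * δ u t) + sumMaybe (λ u → w (shift u) * K u)
      ≈⟨ +-congʳ (*-distribˡ-sumMaybe _ _) ⟩
    sumMaybe (λ u → w (just zero) * (K u * δ u t)) + sumMaybe (λ u → w (shift u) * K u)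
      ≈⟨ sumMaybe-distrib-+ _ _ ⟨
    sumMaybe (λ u → w (just zero) * (K u * δ u t) + w (shift u) * K u)
      ≈⟨ sumMaybe-cong (λ u → regroup (w (just zero)) (K u) (δ u t) (w (shift u))) ⟩
    sumMaybe (λ u → (w (shift u) + w (just zero) * δ u t) * K u) ∎
    where
    regroup : ∀ a k d b → a * (k * d) + b * k ≈ (b + a * d) * k
    regroup = solve 4 (λ a k d b → a :* (k :* d) :+ b :* k := (b :+ a :* d) :* k) refl

  contractedLaw-isValueLaw : ∀ {n} {p π : Fin (suc n) → Carrier} {w} → IsValueLaw p π w →
                             (t : Maybe (Fin n)) →
                             IsValueLaw (p ∘ suc) (contractedDist t π) (contractedLaw t w)
  contractedLaw-isValueLaw {p = p} {π} {w} law t = record { atPoint = atPoint′ ; total = total′ }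
    where
    open IsValueLaw law
    atPoint′ : ∀ i k → contractedLaw t w i (just k) ≈ p (suc i) * contractedDist t π k
    atPoint′ i k = begin
      w (suc i) (just (suc k)) + w (suc i) (just zero) * δ (just k) t
        ≈⟨ +-cong (atPoint _ _) (*-congʳ (atPoint _ _)) ⟩
      p (suc i) * π (suc k) + p (suc i) * π zero * δ (just k) t
        ≈⟨ +-congˡ (*-assoc _ _ _) ⟩
      p (suc i) * π (suc k) + p (suc i) * (π zero * δ (just k) t)
        ≈⟨ distribˡ _ _ _ ⟨
      p (suc i) * contractedDist t π k ∎
    total′ : ∀ i → sumMaybe (contractedLaw t w i) ≈ 1#
    total′ i = begin
      sumMaybe (contractedLaw t w i)              ≈⟨ sumMaybe-cong (λ u → *-identityʳ _) ⟨
      sumMaybe (λ u → contractedLaw t w i u * 1#) ≈⟨ sumMaybe-redirect t (w (suc i)) (λ _ → 1#) ⟨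
      sumMaybe (λ v → w (suc i) v * 1#)           ≈⟨ sumMaybe-cong (λ v → *-identityʳ _) ⟩
      sumMaybe (w (suc i))                        ≈⟨ total (suc i) ⟩
      1#                                          ∎

  contractedDist-sum : ∀ {n} (p π : Fin (suc n) → Carrier) (t : Maybe (Fin n)) →
                       sum (λ k → p (suc k) * contractedDist t π k) ≈
                       sum (λ k → p (suc k) * π (suc k)) + π zero * maybe (p ∘ suc) 0# t
  contractedDist-sum p π t = begin
    sum (λ k → p (suc k) * contractedDist t π k)
      ≈⟨ sum-cong-≋ (λ k → split (p (suc k)) (π (suc k)) (π zero) (δ (just k) t)) ⟩
    sum (λ k → p (suc k) * π (suc k) + π zero * (p (suc k) * δ (just k) t))
      ≈⟨ ∑-distrib-+ (λ k → p (suc k) * π (suc k)) (λ k → π zero * (p (suc k) * δ (just k) t)) ⟩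
    sum (λ k → p (suc k) * π (suc k)) + sum (λ k → π zero * (p (suc k) * δ (just k) t))
      ≈⟨ +-congˡ (*-distribˡ-sum (π zero) (λ k → p (suc k) * δ (just k) t)) ⟨
    sum (λ k → p (suc k) * π (suc k)) + π zero * sum (λ k → p (suc k) * δ (just k) t)
      ≈⟨ +-congˡ (*-congˡ (sum-δ-just (p ∘ suc) t)) ⟩
    sum (λ k → p (suc k) * π (suc k)) + π zero * maybe (p ∘ suc) 0# t ∎
    where
    split : ∀ a b c d → a * (b + c * d) ≈ a * b + c * (a * d)
    split = solve 4 (λ a b c d → a :* (b :+ c :* d) := a :* b :+ c :* (a :* d)) refl

  -- Indicators up to ≈, with no decision procedure: none is available for the contracted maps.
  IsTrapIndicator : ∀ {n} → (Map n → Carrier) → Set (lsuc 0ℓ ⊔ ℓ)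
  IsTrapIndicator H = ∀ f → IsIndicator (Trap f) (H f)

  trapIndicator-resp : ∀ {n} {H : Map n → Carrier} → IsTrapIndicator H →
                       ∀ f g → (∀ i → f i ≡ g i) → H f ≈ H g
  trapIndicator-resp H-ind f g f≗g = isIndicator-unique (trap-cong f≗g) (H-ind f) (H-ind g)

  𝔼-contract : ∀ {n} (w : Fin (suc n) → Maybe (Fin (suc n)) → Carrier) (t : Maybe (Fin n))
               {H : Map (suc n) → Carrier} → IsTrapIndicator H →
               𝔼 (w ∘ suc) (values (suc n)) (λ g → H (shift t ∷ᵥ g)) ≈
               𝔼 (contractedLaw t w) (values n) (λ f → H (shift t ∷ᵥ shift ∘ f))
  𝔼-contract {n} w t {H} H-ind = begin
    𝔼 (w ∘ suc) (values (suc n)) (λ g → H (shift t ∷ᵥ g))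
      ≈⟨ 𝔼-cong (values (suc n)) (w ∘ suc)
                (λ g → isIndicator-unique (trap-reroute g) (H-ind _) (H-ind _)) ⟩
    𝔼 (w ∘ suc) (values (suc n)) (λ g → H (shift t ∷ᵥ shift ∘ redirect t ∘ g))
      ≈⟨ 𝔼-pushforward (values (suc n)) (values n) (redirect t) (w ∘ suc) (contractedLaw t w)
                       law-redirect _ H-resp ⟩
    𝔼 (contractedLaw t w) (values n) (λ f → H (shift t ∷ᵥ shift ∘ f)) ∎
    where
    H-resp : ∀ f g → (∀ i → f i ≡ g i) → H (shift t ∷ᵥ shift ∘ f) ≈ H (shift t ∷ᵥ shift ∘ g)
    H-resp f g f≗g = trapIndicator-resp H-ind _ _ λ { zero → ≡.refl ; (suc i) → ≡.cong shift (f≗g i) }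
    trap-reroute : ∀ g → Trap (shift t ∷ᵥ g) ⇔ Trap (shift t ∷ᵥ shift ∘ redirect t ∘ g)
    trap-reroute g = ⇔.trans (trap-contract t g) (⇔.sym (trap-shift t (redirect t ∘ g)))
    law-redirect : ∀ i K → sumL R (λ v → w (suc i) v * K (redirect t v)) (values (suc n)) ≈
                           sumL R (λ u → contractedLaw t w i u * K u) (values n)
    law-redirect i K = begin
      sumL R (λ v → w (suc i) v * K (redirect t v)) (values (suc n)) ≡⟨ sumL-values _ ⟩
      sumMaybe (λ v → w (suc i) v * K (redirect t v))               ≈⟨ sumMaybe-redirect t (w (suc i)) K ⟩
      sumMaybe (λ u → contractedLaw t w i u * K u)                  ≡⟨ sumL-values _ ⟨
      sumL R (λ u → contractedLaw t w i u * K u) (values n)         ∎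

  first-step-analysis : ∀ {n} {p π : Fin (suc n) → Carrier} {w} → IsValueLaw p π w →
                        (E : Maybe (Fin (suc n)) → Carrier) → E (just zero) ≈ 1# →
                        (∀ t → E (shift t) ≈
                               sum (λ k → p (suc k) * π (suc k)) + π zero * maybe (p ∘ suc) 0# t) →
                        sumMaybe (λ v → w zero v * E v) ≈ sum (λ i → p i * π i)
  first-step-analysis {p = p} {π} {w} law E E-loop E-shift = begin
    sumMaybe (λ v → w₀ v * E v)
      ≈⟨ sumMaybe-shift _ ⟩
    w₀ (just zero) * E (just zero) + sumMaybe (λ t → w₀ (shift t) * E (shift t))
      ≈⟨ +-cong (*-congˡ E-loop) (sumMaybe-cong (λ t → *-congˡ (E-shift t))) ⟩
    w₀ (just zero) * 1# + sumMaybe (λ t → w₀ (shift t) * (X + π zero * p₊ t))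
      ≈⟨ +-congˡ expand ⟩
    w₀ (just zero) * 1# + (X * L + π zero * (p zero * X))
      ≈⟨ regroup _ _ _ _ _ ⟩
    w₀ (just zero) + X * (p zero * π zero + L)
      ≈⟨ +-cong (atPoint zero zero) (*-congˡ (+-congʳ (sym (atPoint zero zero)))) ⟩
    p zero * π zero + X * (w₀ (just zero) + L)
      ≈⟨ +-congˡ (trans (*-congˡ mass) (*-identityʳ X)) ⟩
    p zero * π zero + X ∎
    where
    open IsValueLaw law
    w₀ = w zero
    p₊ = maybe (p ∘ suc) 0#
    X = sum (λ k → p (suc k) * π (suc k))
    L = sumMaybe (w₀ ∘ shift)
    mass : w₀ (just zero) + L ≈ 1#
    mass = trans (sym (sumMaybe-shift w₀)) (total zero)
    regroup : ∀ a x l π₀ p₀ → a * 1# + (x * l + π₀ * (p₀ * x)) ≈ a + x * (p₀ * π₀ + l)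
    regroup = solve 5 (λ a x l π₀ p₀ → a :* con 1 :+ (x :* l :+ π₀ :* (p₀ :* x))
                                    := a :+ x :* (p₀ :* π₀ :+ l)) refl
    mean : sumMaybe (λ t → w₀ (shift t) * p₊ t) ≈ p zero * X
    mean = begin
      sumMaybe (λ t → w₀ (shift t) * p₊ t)                        ≡⟨ sumMaybe-unfold _ ⟩
      w₀ nothing * 0# + sum (λ k → w₀ (just (suc k)) * p (suc k)) ≈⟨ *0+ _ _ ⟩
      sum (λ k → w₀ (just (suc k)) * p (suc k))
        ≈⟨ sum-cong-≋ (λ k → *-congʳ (atPoint zero (suc k))) ⟩
      sum (λ k → p zero * π (suc k) * p (suc k))
        ≈⟨ sum-cong-≋ (λ k → trans (*-assoc (p zero) (π (suc k)) (p (suc k)))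
                                   (*-congˡ (*-comm (π (suc k)) (p (suc k))))) ⟩
      sum (λ k → p zero * (p (suc k) * π (suc k)))
        ≈⟨ *-distribˡ-sum (p zero) (λ k → p (suc k) * π (suc k)) ⟨
      p zero * X                                                  ∎
    expand : sumMaybe (λ t → w₀ (shift t) * (X + π zero * p₊ t)) ≈ X * L + π zero * (p zero * X)
    expand = begin
      sumMaybe (λ t → w₀ (shift t) * (X + π zero * p₊ t))
        ≈⟨ sumMaybe-cong (λ t → split (w₀ (shift t)) X (π zero) (p₊ t)) ⟩
      sumMaybe (λ t → X * w₀ (shift t) + π zero * (w₀ (shift t) * p₊ t))
        ≈⟨ sumMaybe-distrib-+ _ _ ⟩
      sumMaybe (λ t → X * w₀ (shift t)) + sumMaybe (λ t → π zero * (w₀ (shift t) * p₊ t))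
        ≈⟨ +-cong (*-distribˡ-sumMaybe X _) (*-distribˡ-sumMaybe (π zero) _) ⟨
      X * L + π zero * sumMaybe (λ t → w₀ (shift t) * p₊ t)
        ≈⟨ +-congˡ (*-congˡ mean) ⟩
      X * L + π zero * (p zero * X) ∎
      where
      split : ∀ a x π₀ m → a * (x + π₀ * m) ≈ x * a + π₀ * (a * m)
      split = solve 4 (λ a x π₀ m → a :* (x :+ π₀ :* m) := x :* a :+ π₀ :* (a :* m)) refl

  𝔼-trapIndicator : ∀ {n} {p π : Fin n → Carrier} {w} → IsValueLaw p π w →
                    {H : Map n → Carrier} → IsTrapIndicator H →
                    𝔼 w (values n) H ≈ sum (λ i → p i * π i)
  𝔼-trapIndicator {zero} _ H-ind =
    trans (+-identityʳ _) (trans (*-congˡ (isIndicator-fails (H-ind _) (no-trap-Fin0 _))) (zeroʳ _))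
  𝔼-trapIndicator {suc n} {p} {π} {w} law {H} H-ind = begin
    𝔼 w (values (suc n)) H                         ≈⟨ 𝔼-suc (values (suc n)) w H ⟩
    sumL R (λ v → w zero v * E v) (values (suc n)) ≡⟨ sumL-values _ ⟩
    sumMaybe (λ v → w zero v * E v)                ≈⟨ first-step-analysis law E E-loop E-shift ⟩
    sum (λ i → p i * π i)                          ∎
    where
    open IsValueLaw law
    E : Maybe (Fin (suc n)) → Carrier
    E v = 𝔼 (w ∘ suc) (values (suc n)) (λ g → H (v ∷ᵥ g))
    E-loop : E (just zero) ≈ 1#
    E-loop = trans (𝔼-cong _ (w ∘ suc) λ g → isIndicator-holds (H-ind _) (fixedPoint⇒trap {i = zero} ≡.refl))
                   (𝔼-const _ (w ∘ suc) (total-values ∘ suc) 1#)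
    E-shift : ∀ t → E (shift t) ≈ sum (λ k → p (suc k) * π (suc k)) + π zero * maybe (p ∘ suc) 0# t
    E-shift t = begin
      E (shift t)
        ≈⟨ 𝔼-contract w t H-ind ⟩
      𝔼 (contractedLaw t w) (values n) (λ f → H (shift t ∷ᵥ shift ∘ f))
        ≈⟨ 𝔼-trapIndicator (contractedLaw-isValueLaw law t)
                           (λ f → isIndicator-⇔ (trap-shift t f) (H-ind _)) ⟩
      sum (λ k → p (suc k) * contractedDist t π k)
        ≈⟨ contractedDist-sum p π t ⟩
      sum (λ k → p (suc k) * π (suc k)) + π zero * maybe (p ∘ suc) 0# t ∎

  𝔼-numFixed : ∀ {n} {p π : Fin n → Carrier} {w} → IsValueLaw p π w →
               𝔼 w (values n) (numFixed R) ≈ sum (λ i → p i * π i)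
  𝔼-numFixed {n} {p} {π} {w} law = begin
    𝔼 w (values n) (numFixed R)
      ≈⟨ 𝔼-cong (values n) w (λ f → reflexive (∑≡sum (λ i → δ (f i) (just i)))) ⟩
    𝔼 w (values n) (λ f → sum (λ i → δ (f i) (just i)))
      ≈⟨ 𝔼-sum (values n) w total-values (λ i v → δ v (just i)) ⟩
    sum (λ i → sumL R (λ v → w i v * δ v (just i)) (values n))
      ≈⟨ sum-cong-≋ (λ i → trans (reflexive (sumL-values _)) (sumMaybe-δ (w i) (just i))) ⟩
    sum (λ i → w i (just i))
      ≈⟨ sum-cong-≋ (λ i → atPoint i i) ⟩
    sum (λ i → p i * π i) ∎
    where open IsValueLaw law

  valueWeight-isValueLaw : ∀ {n} (p π : Fin n → Carrier) → ∑ R π ≈ 1# →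
                           IsValueLaw p π (valueWeight R p π)
  valueWeight-isValueLaw p π ∑π≈1 = record { atPoint = λ _ _ → refl ; total = total }
    where
    total : ∀ i → sumMaybe (valueWeight R p π i) ≈ 1#
    total i = begin
      sumMaybe (valueWeight R p π i)     ≡⟨ sumMaybe-unfold _ ⟩
      (1# - p i) + sum (λ j → p i * π j) ≈⟨ +-congˡ (*-distribˡ-sum (p i) π) ⟨
      (1# - p i) + p i * sum π           ≡⟨ ≡.cong (λ s → (1# - p i) + p i * s) (∑≡sum π) ⟨
      (1# - p i) + p i * ∑ R π           ≈⟨ +-congˡ (trans (*-congˡ ∑π≈1) (*-identityʳ (p i))) ⟩
      (1# - p i) + p i                   ≈⟨ //-rightDividesˡ (p i) 1# ⟩
      1#                                 ∎

  ∑-*-uniform : ∀ {n} (p π : Fin n → Carrier) (q : Carrier) → (∀ i → p i ≈ q) → ∑ R π ≈ 1# →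
                ∑ R (λ i → p i * π i) ≈ q
  ∑-*-uniform p π q p≈q ∑π≈1 = begin
    ∑ R (λ i → p i * π i) ≡⟨ ∑≡sum (λ i → p i * π i) ⟩
    sum (λ i → p i * π i) ≈⟨ sum-cong-≋ (λ i → *-congʳ {π i} (p≈q i)) ⟩
    sum (λ i → q * π i)   ≈⟨ *-distribˡ-sum q π ⟨
    q * sum π             ≡⟨ ≡.cong (q *_) (∑≡sum π) ⟨
    q * ∑ R π             ≈⟨ *-congˡ ∑π≈1 ⟩
    q * 1#                ≈⟨ *-identityʳ q ⟩
    q                     ∎

lemma2p1 : {c ℓ : Level} (R : CommutativeRing c ℓ) → let open CommutativeRing R in
    (n : ℕ) (π p : Fin (suc n) → Carrier) →
    ∑ R π ≈ 1# →
    (d : (f : Map (suc n)) → Dec (HasCycle f)) →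
    (probCycle R p π d ≈ ∑ R (λ i → p i * π i))
    × ((q : Carrier) → (∀ i → p i ≈ q) → probCycle R p π d ≈ q)
    × (probCycle R p π d ≈ expFixed R p π)
lemma2p1 R n π p ∑π≈1 d = cycles , uniform , trans cycles (sym fixedPoints)
  where
  open CommutativeRing R
  open Probability R
  open import Algebra.Properties.Semiring.Sum semiring using (sum)
  open import Relation.Binary.Reasoning.Setoid setoid
  law : IsValueLaw p π (valueWeight R p π)
  law = valueWeight-isValueLaw p π ∑π≈1
  hasCycle-isTrapIndicator : IsTrapIndicator (λ f → indicator R (d f))
  hasCycle-isTrapIndicator f = isIndicator-⇔ cycle⇔trap (indicator-isIndicator (d f))
  cycles : probCycle R p π d ≈ ∑ R (λ i → p i * π i)
  cycles = begin
    probCycle R p π d     ≈⟨ 𝔼-trapIndicator law hasCycle-isTrapIndicator ⟩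
    sum (λ i → p i * π i) ≡⟨ ∑≡sum (λ i → p i * π i) ⟨
    ∑ R (λ i → p i * π i) ∎
  uniform : (q : Carrier) → (∀ i → p i ≈ q) → probCycle R p π d ≈ q
  uniform q p≈q = trans cycles (∑-*-uniform p π q p≈q ∑π≈1)
  fixedPoints : expFixed R p π ≈ ∑ R (λ i → p i * π i)
  fixedPoints = begin
    expFixed R p π        ≈⟨ 𝔼-numFixed law ⟩
    sum (λ i → p i * π i) ≡⟨ ∑≡sum (λ i → p i * π i) ⟨
    ∑ R (λ i → p i * π i) ∎
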